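{- Let $m \ge 3$ be odd and $k \in \{2, 4, \ldots, m-1\}$. Let $\mathcal{P}_{m,k} = \{ p \text{ prime} : (p-1) \mid k \text{ and } p \nmid \binom{m}{k}\}$. Then $$\max(\mathcal{P}_{m,k}) \le \min\!\left(k+1, \frac{m+1}{2}\right),$$ with the convention $\max(\emptyset) = 0$. -}

module Defs where

open import Data.Nat using (ℕ; _∸_; _+_; _/_)
open import Data.Nat.Primality using (Prime)
open import Data.Nat.Divisibility using (_∣_; _∤_)
open import Data.Nat.Combinatorics using (_C_)
open import Data.Product using (_×_)

InP : ℕ → ℕ → ℕ → Set
InP m k p = Prime p × ((p ∸ 1) ∣ k) × (p ∤ (m C k))

{-# OPTIONS --safe #-}
-- Write p = a + 1. The bound p ≤ k + 1 is just a ∣ k with k ≠ 0. If p > (m + 1)/2, then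
-- m ≤ 2a, so the multiple k of a lies in (0, 2a) and must be a itself. Then k < p,
-- m − k ≤ a < p and p ≤ m, so p divides m! = (m C k) · k! · (m − k)! but neither k! nor
-- (m − k)!; hence p ∣ m C k.
module Submission where

open import Defs
open import Data.Nat using (ℕ; zero; suc; _≤_; _<_; _+_; _*_; _∸_; _/_; _⊓_; _!; z≤n; s≤s; s≤s⁻¹; NonZero; >-nonZero; ≢-nonZero⁻¹; nonTrivial⇒n>1)
open import Data.Nat.Properties
open import Data.Nat.Divisibility using (_∣_; _∤_; divides; ∣⇒≤; >⇒∤; ∣-trans; m∣m*n; m≤n⇒m!∣n!)
open import Data.Nat.DivMod using (m/n*n≡m; m*n/n≡m; /-monoˡ-≤)
open import Data.Nat.Primality using (Prime; ¬prime[0]; prime⇒nonZero; prime⇒nonTrivial; euclidsLemma)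
open import Data.Nat.Combinatorics using (_C_; nCk≡n!/k![n-k]!; k![n∸k]!∣n!)
open import Data.Product using (_,_)
open import Data.Empty using (⊥-elim)
open import Data.Sum using ([_,_]′; fromInj₁)
open import Function using (_∘_)
open import Relation.Nullary using (contradiction)
open import Relation.Nullary.Decidable using (decidable-stable)
open import Relation.Binary.PropositionalEquality using (_≡_; sym; trans; cong; subst; module ≡-Reasoning)

n∣m! : ∀ {n m} → .{{NonZero n}} → n ≤ m → n ∣ m !
n∣m! {suc n} n≤m = ∣-trans (m∣m*n (n !)) (m≤n⇒m!∣n! n≤m)

prime∤n! : ∀ {p} n → Prime p → n < p → p ∤ n !
prime∤n! zero    p-prime _   = >⇒∤ (nonTrivial⇒n>1 _ {{prime⇒nonTrivial p-prime}})
prime∤n! (suc n) p-prime n<p =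
  [ >⇒∤ n<p , prime∤n! n p-prime (<⇒≤ n<p) ]′ ∘ euclidsLemma (suc n) (n !) p-prime

nCk*[k!*[n∸k]!]≡n! : ∀ {n k} → k ≤ n → (n C k) * (k ! * (n ∸ k) !) ≡ n !
nCk*[k!*[n∸k]!]≡n! {n} {k} k≤n = begin
  (n C k) * (k ! * (n ∸ k) !)                 ≡⟨ cong (_* (k ! * (n ∸ k) !)) (nCk≡n!/k![n-k]! k≤n) ⟩
  n ! / (k ! * (n ∸ k) !) * (k ! * (n ∸ k) !) ≡⟨ m/n*n≡m (k![n∸k]!∣n! k≤n) ⟩
  n !                                         ∎
  where
  open ≡-Reasoning
  instance _ = k !* (n ∸ k) !≢0

prime∣nCk : ∀ {p n k} → Prime p → k < p → n ∸ k < p → p ≤ n → p ∣ n C k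
prime∣nCk {p} {n} {k} p-prime k<p n∸k<p p≤n =
  fromInj₁ (⊥-elim ∘ p∤k![n∸k]!) (euclidsLemma (n C k) (k ! * (n ∸ k) !) p-prime p∣nCk*k![n∸k]!)
  where
  instance _ = prime⇒nonZero p-prime
  p∣nCk*k![n∸k]! : p ∣ (n C k) * (k ! * (n ∸ k) !)
  p∣nCk*k![n∸k]! = subst (p ∣_) (sym (nCk*[k!*[n∸k]!]≡n! (<⇒≤ (<-≤-trans k<p p≤n)))) (n∣m! p≤n)
  p∤k![n∸k]! : p ∤ k ! * (n ∸ k) !
  p∤k![n∸k]! = [ prime∤n! k p-prime k<p , prime∤n! (n ∸ k) p-prime n∸k<p ]′
             ∘ euclidsLemma (k !) ((n ∸ k) !) p-prime

m∣n∧n<2m⇒n≡m : ∀ {m n} → .{{NonZero n}} → m ∣ n → n < 2 * m → n ≡ m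
m∣n∧n<2m⇒n≡m {n = n} (divides zero n≡0)            _    = contradiction n≡0 (≢-nonZero⁻¹ n)
m∣n∧n<2m⇒n≡m {m}     (divides (suc zero) n≡1*m)    _    = trans n≡1*m (*-identityˡ m)
m∣n∧n<2m⇒n≡m {m}     (divides (suc (suc q)) n≡q*m) n<2m =
  contradiction (subst (2 * m ≤_) (sym n≡q*m) (*-monoˡ-≤ m {2} {suc (suc q)} (s≤s (s≤s z≤n)))) (<⇒≱ n<2m)

prime∣nCk-of-pred∣k : ∀ {a n k} → .{{NonZero k}} → Prime (suc a) → a ∣ k → k < n → n ≤ 2 * a →
                      suc a ∣ n C k
prime∣nCk-of-pred∣k {a} {n} {k} p-prime a∣k k<n n≤2a =
  prime∣nCk p-prime (s≤s (≤-reflexive k≡a)) (s≤s (m≤n+o⇒m∸n≤o n k n≤k+a)) (subst (_< n) k≡a k<n)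
  where
  k≡a : k ≡ a
  k≡a = m∣n∧n<2m⇒n≡m a∣k (<-≤-trans k<n n≤2a)
  n≤k+a : n ≤ k + a
  n≤k+a = begin
    n      ≤⟨ n≤2a ⟩
    2 * a  ≡⟨ cong (a +_) (+-identityʳ a) ⟩
    a + a  ≡⟨ cong (_+ a) k≡a ⟨
    k + a  ∎
    where open ≤-Reasoning

prime≤[n+1]/2 : ∀ {a n k} → .{{NonZero k}} → Prime (suc a) → a ∣ k → k < n → suc a ∤ n C k →
                suc a ≤ (n + 1) / 2
prime≤[n+1]/2 {a} {n} p-prime a∣k k<n p∤nCk =
  subst (_≤ (n + 1) / 2) (m*n/n≡m (suc a) 2) (/-monoˡ-≤ 2 p*2≤n+1)
  where
  n+1<p*2⇒n≤2a : n + 1 < suc a * 2 → n ≤ 2 * a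
  n+1<p*2⇒n≤2a lt = subst (n ≤_) (*-comm a 2) (s≤s⁻¹ (s≤s⁻¹ (subst (_< suc a * 2) (+-comm n 1) lt)))
  p*2≤n+1 : suc a * 2 ≤ n + 1
  p*2≤n+1 = decidable-stable (suc a * 2 ≤? n + 1)
    (p∤nCk ∘ prime∣nCk-of-pred∣k p-prime a∣k k<n ∘ n+1<p*2⇒n≤2a ∘ ≰⇒>)

lemma4 : (m k : ℕ) → 3 ≤ m → 2 ∤ m → 2 ∣ k → 2 ≤ k → k ≤ m ∸ 1 → (p : ℕ) → InP m k p →
    p ≤ (suc k ⊓ ((m + 1) / 2))
lemma4 _       _ _ _ _ _   _   zero    (p-prime , _) = contradiction p-prime ¬prime[0]
lemma4 (suc m) k _ _ _ 2≤k k≤m (suc a) (p-prime , a∣k , p∤mCk) =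
  ⊓-glb (s≤s (∣⇒≤ a∣k)) (prime≤[n+1]/2 p-prime a∣k (s≤s k≤m) p∤mCk)
  where instance _ = >-nonZero (≤-trans (s≤s z≤n) 2≤k)
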